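{- Let $m \geq 3$ and $r_1, \dots, r_m \geq 3$, and let $G$ be a complete $m$-partite graph $K_{r_1,\dots,r_m}$ (with labeled vertex set $V$). Then for every integer $k$ with $2 \leq k \leq \min\{r_1,\dots,r_m\}$, $G$ is uniquely reconstructible from $T_k(G)$ among complete multipartite graphs: if $G'$ is a complete multipartite graph on the vertex set $V$ with $T_k(G') = T_k(G)$, then $G' = G$.
   Context: Graphs are finite, simple, labeled; two labeled graphs are equal if they have the same vertex set and the same edge set. For $k \geq 2$, $T_k(G) = \{X \subseteq V(G) : |X| = k \text{ and the subgraph of } G \text{ induced by } X \text{ is connected}\}$. -}

module Defs where

open import Data.Nat using (ℕ; _≤_)
open import Data.Bool using (Bool; true; false)
open import Data.Fin using (Fin; _≟_)
open import Data.Fin.Subset using (Subset; _∈_; ∣_∣)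
open import Data.List using (length; filter)
open import Data.Product using (Σ; _×_)
open import Relation.Binary.PropositionalEquality using (_≡_; _≢_)
open import Function.Bundles using (_⇔_)
import Data.List as L

record Graph (n : ℕ) : Set where
  field
    adj   : Fin n → Fin n → Bool
    sym   : ∀ u v → adj u v ≡ adj v u
    irref : ∀ u → adj u u ≡ false
open Graph public

_≈G_ : ∀ {n} → Graph n → Graph n → Set
G ≈G H = ∀ u v → adj G u v ≡ adj H u v

data Walk {n} (G : Graph n) (X : Subset n) : Fin n → Fin n → Set where
  here : ∀ {u} → u ∈ X → Walk G X u u
  step : ∀ {u w v} → u ∈ X → adj G u w ≡ true → Walk G X w v → Walk G X u v

InducedConnected : ∀ {n} → Graph n → Subset n → Set
InducedConnected G X = ∀ u v → u ∈ X → v ∈ X → Walk G X u v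

InT : ∀ {n} → ℕ → Graph n → Subset n → Set
InT k G X = (∣ X ∣ ≡ k) × InducedConnected G X

SameT : ∀ {n} → ℕ → Graph n → Graph n → Set
SameT k G H = ∀ X → InT k G X ⇔ InT k H X

partSize : ∀ {n m} → (Fin n → Fin m) → Fin m → ℕ
partSize {n} p i = length (filter (λ v → p v ≟ i) (L.allFin n))

IsCompleteMultipartiteWith : ∀ {n m} → Graph n → (Fin m → ℕ) → Set
IsCompleteMultipartiteWith {n} {m} G r =
  Σ (Fin n → Fin m) λ p →
    (∀ i → partSize p i ≡ r i) × (∀ u v → (adj G u v ≡ true) ⇔ (p u ≢ p v))

IsCompleteMultipartite : ∀ {n} → Graph n → Set
IsCompleteMultipartite {n} G =
  Σ ℕ λ m → Σ (Fin m → ℕ) λ r →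
    (∀ i → 1 ≤ r i) × IsCompleteMultipartiteWith G r

{-# OPTIONS --safe #-}
-- Two vertices u ≠ v in one part of G lie in a k-subset of that
-- part (parts have ≥ k vertices); it is independent in G, hence not in T_k(G),
-- so u and v cannot be in different parts of G', where any k-set meeting two parts
-- is connected. Conversely, if u, v share a part of G' but not of G, extend {u, v}
-- inside (part of u in G) ∪ {v}: this k-set is connected in G, yet by the first
-- half it lies in a single part of G', so it is independent there.
module Submission where

open import Defs hiding (sym)
open import Data.Nat using (ℕ; zero; suc; _≤_; _+_; z≤n; s≤s)
open import Data.Nat.Properties
  using (≤-trans; ≤-reflexive; ≤-antisym; _≤?_; ≰⇒>; +-suc; +-monoʳ-≤; n≤1+n; n≤0⇒n≡0)
open import Data.Bool using (Bool; true; false)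
open import Data.Bool.Properties using (⇔→≡)
open import Data.Fin using (Fin; _≟_)
import Data.Fin as Fin
open import Data.Fin.Subset using (Subset; _∈_; _⊆_; _∪_; ⁅_⁆; ∣_∣; inside; outside)
open import Data.Fin.Subset.Properties
  using (drop-∷-⊆; s⊆s; out⊆; ⊆-refl; ∣⁅x⁆∣≡1; x∈⁅x⁆; x∈⁅y⁆⇒x≡y; x∈p∪q⁺; x∈p∪q⁻; ∣p∣≤∣p∪q∣)
open import Data.List using (length; filter)
import Data.List as List
open import Data.Vec using (_∷_; []; here; tabulate)
open import Data.Vec.Properties using (lookup∘tabulate; lookup⇒[]=; []=⇒lookup)
open import Data.Product using (Σ; _×_; _,_; proj₂)
open import Data.Sum using (inj₁; inj₂)
open import Data.Empty using (⊥)
open import Level using (0ℓ)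
open import Relation.Nullary using (Dec; does; yes; no; contradiction)
open import Relation.Nullary.Decidable using (decidable-stable)
open import Relation.Unary using (Pred; Decidable)
open import Relation.Binary.PropositionalEquality using (_≡_; _≢_; refl; sym; trans; cong; cong₂; subst)
open import Function using (id; _∘_)
open import Function.Bundles using (_⇔_; mk⇔; Equivalence)
open Equivalence using (to; from)

∣p∪q∣≤∣p∣+∣q∣ : ∀ {n} (p q : Subset n) → ∣ p ∪ q ∣ ≤ ∣ p ∣ + ∣ q ∣
∣p∪q∣≤∣p∣+∣q∣ []            []            = z≤n
∣p∪q∣≤∣p∣+∣q∣ (inside  ∷ p) (inside  ∷ q) = s≤s (≤-trans (∣p∪q∣≤∣p∣+∣q∣ p q) (+-monoʳ-≤ ∣ p ∣ (n≤1+n ∣ q ∣)))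
∣p∪q∣≤∣p∣+∣q∣ (inside  ∷ p) (outside ∷ q) = s≤s (∣p∪q∣≤∣p∣+∣q∣ p q)
∣p∪q∣≤∣p∣+∣q∣ (outside ∷ p) (inside  ∷ q) = ≤-trans (s≤s (∣p∪q∣≤∣p∣+∣q∣ p q)) (≤-reflexive (sym (+-suc ∣ p ∣ ∣ q ∣)))
∣p∪q∣≤∣p∣+∣q∣ (outside ∷ p) (outside ∷ q) = ∣p∪q∣≤∣p∣+∣q∣ p q

⊆-extend : ∀ {n} k (M S : Subset n) → M ⊆ S → ∣ M ∣ ≤ k → k ≤ ∣ S ∣ →
           Σ (Subset n) λ X → M ⊆ X × X ⊆ S × ∣ X ∣ ≡ k
⊆-extend k [] [] _ _ k≤0 = [] , (λ ()) , (λ ()) , sym (n≤0⇒n≡0 k≤0)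
⊆-extend k (inside ∷ M) (outside ∷ S) M⊆S _ _ = contradiction (M⊆S here) λ ()
⊆-extend (suc k) (inside ∷ M) (inside ∷ S) M⊆S (s≤s ∣M∣≤k) (s≤s k≤∣S∣)
  with X , M⊆X , X⊆S , ∣X∣≡k ← ⊆-extend k M S (drop-∷-⊆ M⊆S) ∣M∣≤k k≤∣S∣
  = inside ∷ X , s⊆s M⊆X , s⊆s X⊆S , cong suc ∣X∣≡k
⊆-extend k (outside ∷ M) (outside ∷ S) M⊆S ∣M∣≤k k≤∣S∣
  with X , M⊆X , X⊆S , ∣X∣≡k ← ⊆-extend k M S (drop-∷-⊆ M⊆S) ∣M∣≤k k≤∣S∣
  = outside ∷ X , s⊆s M⊆X , s⊆s X⊆S , ∣X∣≡k
⊆-extend k (outside ∷ M) (inside ∷ S) M⊆S ∣M∣≤k k≤1+∣S∣ with k ≤? ∣ S ∣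
... | yes k≤∣S∣ with X , M⊆X , X⊆S , ∣X∣≡k ← ⊆-extend k M S (drop-∷-⊆ M⊆S) ∣M∣≤k k≤∣S∣
  = outside ∷ X , s⊆s M⊆X , out⊆ X⊆S , ∣X∣≡k
... | no k≰∣S∣ = inside ∷ S , M⊆S , ⊆-refl , ≤-antisym (≰⇒> k≰∣S∣) k≤1+∣S∣

⊆-extend-pair : ∀ {n k} {u v : Fin n} {S : Subset n} → u ∈ S → v ∈ S → 2 ≤ k → k ≤ ∣ S ∣ →
                Σ (Subset n) λ X → u ∈ X × v ∈ X × X ⊆ S × ∣ X ∣ ≡ k
⊆-extend-pair {k = k} {u} {v} {S} u∈S v∈S 2≤k k≤∣S∣ =
  let X , uv⊆X , X⊆S , ∣X∣≡k = ⊆-extend k (⁅ u ⁆ ∪ ⁅ v ⁆) S uv⊆S ∣uv∣≤k k≤∣S∣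
  in  X , uv⊆X (x∈p∪q⁺ (inj₁ (x∈⁅x⁆ u))) , uv⊆X (x∈p∪q⁺ (inj₂ (x∈⁅x⁆ v))) , X⊆S , ∣X∣≡k
  where
  uv⊆S : ⁅ u ⁆ ∪ ⁅ v ⁆ ⊆ S
  uv⊆S x∈uv with x∈p∪q⁻ ⁅ u ⁆ ⁅ v ⁆ x∈uv
  ... | inj₁ x∈u = subst (_∈ S) (sym (x∈⁅y⁆⇒x≡y u x∈u)) u∈S
  ... | inj₂ x∈v = subst (_∈ S) (sym (x∈⁅y⁆⇒x≡y v x∈v)) v∈S

  ∣uv∣≤k : ∣ ⁅ u ⁆ ∪ ⁅ v ⁆ ∣ ≤ k
  ∣uv∣≤k = ≤-trans (∣p∪q∣≤∣p∣+∣q∣ ⁅ u ⁆ ⁅ v ⁆)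
                   (subst (_≤ k) (sym (cong₂ _+_ (∣⁅x⁆∣≡1 u) (∣⁅x⁆∣≡1 v))) 2≤k)

∈-tabulate : ∀ {n} (f : Fin n → Bool) {x} → x ∈ tabulate f ⇔ f x ≡ true
∈-tabulate f {x} = mk⇔ (λ x∈ → trans (sym (lookup∘tabulate f x)) ([]=⇒lookup x∈))
                       (λ fx → lookup⇒[]= x (tabulate f) (trans (lookup∘tabulate f x) fx))

∣tabulate-does∣≡length-filter : ∀ {n} {A : Set} {P : Pred A 0ℓ} (P? : Decidable P) (g : Fin n → A) →
                                 ∣ tabulate (λ x → does (P? (g x))) ∣ ≡ length (filter P? (List.tabulate g))
∣tabulate-does∣≡length-filter {zero}  P? g = refl
∣tabulate-does∣≡length-filter {suc n} P? g with does (P? (g Fin.zero))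
... | true  = cong suc (∣tabulate-does∣≡length-filter P? (g ∘ Fin.suc))
... | false = ∣tabulate-does∣≡length-filter P? (g ∘ Fin.suc)

part : ∀ {n m} → (Fin n → Fin m) → Fin m → Subset n
part p c = tabulate (λ x → does (p x ≟ c))

does≡true⇔ : ∀ {A : Set} (a? : Dec A) → does a? ≡ true ⇔ A
does≡true⇔ (yes a) = mk⇔ (λ _ → a) (λ _ → refl)
does≡true⇔ (no ¬a) = mk⇔ (λ ()) (λ a → contradiction a ¬a)

∈-part : ∀ {n m} (p : Fin n → Fin m) c {x} → x ∈ part p c ⇔ p x ≡ c
∈-part p c {x} =
  mk⇔ (to (does≡true⇔ (p x ≟ c)) ∘ to (∈-tabulate _))
      (from (∈-tabulate _) ∘ from (does≡true⇔ (p x ≟ c)))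

∣part∣≡partSize : ∀ {n m} (p : Fin n → Fin m) c → ∣ part p c ∣ ≡ partSize p c
∣part∣≡partSize p c = ∣tabulate-does∣≡length-filter (λ x → p x ≟ c) id

CompleteMultipartiteOn : ∀ {n m} → Graph n → (Fin n → Fin m) → Set
CompleteMultipartiteOn G p = ∀ u v → (adj G u v ≡ true) ⇔ (p u ≢ p v)

walk-start : ∀ {n} {G : Graph n} {X u v} → Walk G X u v → u ∈ X
walk-start (here u∈X)     = u∈X
walk-start (step u∈X _ _) = u∈X

module _ {n m} {G : Graph n} {p : Fin n → Fin m} (G-parts : CompleteMultipartiteOn G p) where

  step-across : ∀ {X u w v} → u ∈ X → p u ≢ p w → Walk G X w v → Walk G X u v
  step-across {u = u} {w} u∈X pu≢pw = step u∈X (from (G-parts u w) pu≢pw)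

  crossing⇒connected : ∀ {X a b} → a ∈ X → b ∈ X → p a ≢ p b → InducedConnected G X
  crossing⇒connected {X} {a} {b} a∈X b∈X pa≢pb x y x∈X y∈X with p x ≟ p y
  ... | no px≢py = step-across x∈X px≢py (here y∈X)
  ... | yes px≡py with p x ≟ p a
  ...   | no px≢pa =
          step-across x∈X px≢pa (step-across a∈X (px≢pa ∘ trans px≡py ∘ sym) (here y∈X))
  ...   | yes px≡pa =
          step-across x∈X (pa≢pb ∘ trans (sym px≡pa))
            (step-across b∈X (pa≢pb ∘ trans (sym px≡pa) ∘ trans px≡py ∘ sym) (here y∈X))

  walk-within-part : ∀ {X c u v} → (∀ {x} → x ∈ X → p x ≡ c) → Walk G X u v → u ≡ v
  walk-within-part in-c (here _) = refl
  walk-within-part in-c (step {u} {w} u∈X uw w⇝v) =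
    contradiction (trans (in-c u∈X) (sym (in-c (walk-start w⇝v)))) (to (G-parts u w) uw)

crossing-k-set-not-within-part :
  ∀ {n m m' k} {H H' : Graph n} {a : Fin n → Fin m} {b : Fin n → Fin m'} {X u v c} →
  CompleteMultipartiteOn H a → CompleteMultipartiteOn H' b → (InT k H X → InT k H' X) →
  ∣ X ∣ ≡ k → u ∈ X → v ∈ X → a u ≢ a v → (∀ {x} → x ∈ X → b x ≡ c) → ⊥
crossing-k-set-not-within-part {H' = H'} {a} {X = X} {u} {v}
                               H-parts H'-parts T⊆T′ ∣X∣≡k u∈X v∈X au≢av in-c =
  au≢av (cong a (walk-within-part H'-parts in-c (H'-connected u v u∈X v∈X)))
  where
  H'-connected : InducedConnected H' X
  H'-connected = proj₂ (T⊆T′ (∣X∣≡k , crossing⇒connected H-parts u∈X v∈X au≢av))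

module _ {n m m' k} {G G' : Graph n} {p : Fin n → Fin m} {q : Fin n → Fin m'}
         (G-parts : CompleteMultipartiteOn G p) (G'-parts : CompleteMultipartiteOn G' q)
         (2≤k : 2 ≤ k) (parts-large : ∀ c → k ≤ ∣ part p c ∣) (same : SameT k G' G) where

  same-part⇒same-part′ : ∀ u v → p u ≡ p v → q u ≡ q v
  same-part⇒same-part′ u v pu≡pv = decidable-stable (q u ≟ q v) λ qu≢qv →
    let X , u∈X , v∈X , X⊆part , ∣X∣≡k =
          ⊆-extend-pair (from (∈-part p (p u)) refl) (from (∈-part p (p u)) (sym pu≡pv)) 2≤k (parts-large (p u))
    in  crossing-k-set-not-within-part G'-parts G-parts (to (same X)) ∣X∣≡k u∈X v∈X qu≢qv
          (to (∈-part p (p u)) ∘ X⊆part)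

  same-part′⇒same-part : ∀ u v → q u ≡ q v → p u ≡ p v
  same-part′⇒same-part u v qu≡qv = decidable-stable (p u ≟ p v) λ pu≢pv →
    let X , u∈X , v∈X , X⊆S , ∣X∣≡k =
          ⊆-extend-pair (x∈p∪q⁺ (inj₁ (from (∈-part p (p u)) refl))) (x∈p∪q⁺ (inj₂ (x∈⁅x⁆ v))) 2≤k
                        (≤-trans (parts-large (p u)) (∣p∣≤∣p∪q∣ (part p (p u)) ⁅ v ⁆))
    in  crossing-k-set-not-within-part G-parts G'-parts (from (same X)) ∣X∣≡k u∈X v∈X pu≢pv
          (in-part-of-u ∘ X⊆S)
    where
    in-part-of-u : ∀ {x} → x ∈ part p (p u) ∪ ⁅ v ⁆ → q x ≡ q u
    in-part-of-u {x} x∈S with x∈p∪q⁻ (part p (p u)) ⁅ v ⁆ x∈S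
    ... | inj₁ x∈part = same-part⇒same-part′ x u (to (∈-part p (p u)) x∈part)
    ... | inj₂ x∈v    = trans (cong q (x∈⁅y⁆⇒x≡y v x∈v)) (sym qu≡qv)

same-partition⇒≈G : ∀ {n m m'} {G H : Graph n} {p : Fin n → Fin m} {q : Fin n → Fin m'} →
                    CompleteMultipartiteOn G p → CompleteMultipartiteOn H q →
                    (∀ u v → p u ≡ p v ⇔ q u ≡ q v) → G ≈G H
same-partition⇒≈G G-parts H-parts p⇔q u v = ⇔→≡ (mk⇔
  (λ Guv → from (H-parts u v) (to (G-parts u v) Guv ∘ from (p⇔q u v)))
  (λ Huv → from (G-parts u v) (to (H-parts u v) Huv ∘ to (p⇔q u v))))

theorem2p3 : (n m : ℕ) → 3 ≤ m → (r : Fin m → ℕ) → (∀ i → 3 ≤ r i) →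
    (G : Graph n) → IsCompleteMultipartiteWith G r →
    (k : ℕ) → 2 ≤ k → (∀ i → k ≤ r i) →
    (G' : Graph n) → IsCompleteMultipartite G' → SameT k G' G →
    G' ≈G G
theorem2p3 n m _ r _ G (p , part-sizes , G-parts) k 2≤k k≤r G' (_ , _ , _ , q , _ , G'-parts) same =
  same-partition⇒≈G {G = G'} {H = G} G'-parts G-parts λ u v →
    mk⇔ (same-part′⇒same-part G-parts G'-parts 2≤k parts-large same u v)
        (same-part⇒same-part′ G-parts G'-parts 2≤k parts-large same u v)
  where
  parts-large : ∀ c → k ≤ ∣ part p c ∣
  parts-large c = subst (k ≤_) (sym (trans (∣part∣≡partSize p c) (part-sizes c))) (k≤r c)
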